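{- Assume the following holds for every elliptic curve $E'/\mathbb{Q}$ given by a Weierstrass equation with integer coefficients: for all $\epsilon>0$ there is a constant $c_\epsilon$ with $\max\{\frac12\log|a_P|,\log|d_P|\}\le(1+\epsilon)\log\operatorname{rad}(d_P)+c_\epsilon$ for all $P\in E'(\mathbb{Q})\setminus\{O\}$. Let $E/\mathbb{Q}$ be an elliptic curve given by a Weierstrass equation with integer coefficients. Then the set of $P\in E(\mathbb{Q})\setminus\{O\}$ such that $d_P$ is a perfect power (i.e. $d_P=m^n$ for some integers $m\ge1$, $n\ge2$) is finite.
   Context: $O$ is the point at infinity. Every $P\in E(\mathbb{Q})\setminus\{O\}$ is written $P=(a_P/d_P^2,\,b_P/d_P^3)$ with $a_P,b_P,d_P\in\mathbb{Z}$, $d_P\ge1$, $\gcd(d_P,a_Pb_P)=1$. $\operatorname{rad}(n)$ is the product of distinct primes dividing $n$. -}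

module Defs where

open import Data.Nat as ℕ using (ℕ; suc; _^_; _≤_)
open import Data.Nat.Divisibility using (_∣?_)
open import Data.Nat.ListAction using (product)
open import Data.Nat.Primality using (prime?)
open import Data.Nat.GCD using (gcd)
open import Data.Integer as Z using (ℤ; +_; ∣_∣)
open import Data.Rational as Q using (ℚ)
open import Data.List using (List; filter; upTo)
open import Data.List.Membership.Propositional using (_∈_)
open import Data.Product using (Σ; ∃; _×_; _,_)
open import Relation.Nullary using (¬_)
open import Relation.Nullary.Decidable using (_×-dec_)
open import Relation.Binary.PropositionalEquality using (_≡_)

rad : ℕ → ℕ
rad n = product (filter (λ p → prime? p ×-dec p ∣? n) (upTo (suc n)))

-- Weierstrass equation y² + a1 x y + a3 y = x³ + a2 x² + a4 x + a6 with integer coefficients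
record Weierstrass : Set where
  field
    a₁ a₂ a₃ a₄ a₆ : ℤ

open Weierstrass public

module _ (E : Weierstrass) where
  open Z using (_+_; _-_; _*_; -_)
  b₂ b₄ b₆ b₈ : ℤ
  b₂ = a₁ E * a₁ E + + 4 * a₂ E
  b₄ = + 2 * a₄ E + a₁ E * a₃ E
  b₆ = a₃ E * a₃ E + + 4 * a₆ E
  b₈ = a₁ E * a₁ E * a₆ E + + 4 * a₂ E * a₆ E - a₁ E * a₃ E * a₄ E
       + a₂ E * a₃ E * a₃ E - a₄ E * a₄ E

  discriminant : ℤ
  discriminant = - (b₂ * b₂ * b₈) - + 8 * (b₄ * b₄ * b₄) - + 27 * (b₆ * b₆)
                 + + 9 * b₂ * b₄ * b₆

fromℤ : ℤ → ℚ
fromℤ z = z Q./ 1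

record EllipticCurve : Set where
  field
    eqn : Weierstrass
    nonsingular : ¬ (discriminant eqn ≡ + 0)

open EllipticCurve public

-- (x , y) is an affine rational point, i.e. a point of E(ℚ) ∖ {O}
OnCurve : EllipticCurve → ℚ → ℚ → Set
OnCurve E x y =
  y * y + fromℤ (a₁ W) * x * y + fromℤ (a₃ W) * y
    ≡ x * x * x + fromℤ (a₂ W) * x * x + fromℤ (a₄ W) * x + fromℤ (a₆ W)
  where
    open Q using (_+_; _*_)
    W = eqn E

Repr : ℚ → ℚ → ℤ → ℤ → ℕ → Set
Repr x y a b d =
  1 ≤ d × gcd d ∣ a Z.* b ∣ ≡ 1
  × x Q.* fromℤ (+ (d ^ 2)) ≡ fromℤ a
  × y Q.* fromℤ (+ (d ^ 3)) ≡ fromℤ b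

PerfectPower : ℕ → Set
PerfectPower d = Σ ℕ λ m → Σ ℕ λ n → 1 ≤ m × 2 ≤ n × d ≡ m ^ n

-- the hypothesis, for a given curve, with ε = p/q (p, q ≥ 1) and the exponentiated
-- bound max{|a|^{1/2}, d} ≤ C · rad(d)^{1+ε}, raised to the q-th power
RadicalBound : EllipticCurve → Set
RadicalBound E =
  (p q : ℕ) → 1 ≤ p → 1 ≤ q →
  Σ ℕ λ C → (x y : ℚ) → OnCurve E x y → (a b : ℤ) (d : ℕ) → Repr x y a b d →
    (d ^ q ≤ C ℕ.* rad d ^ (q ℕ.+ p)) ×
    (∣ a ∣ ^ q ≤ C ℕ.* rad d ^ (2 ℕ.* (q ℕ.+ p)))

FinitePoints : (ℚ → ℚ → Set) → Set
FinitePoints S = Σ (List (ℚ × ℚ)) λ L → (x y : ℚ) → S x y → (x , y) ∈ L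

module Submission where

-- Fix E and apply the hypothesis to E itself with ε = 1/2: there
-- is C such that every affine point P = (a/d², b/d³) of E satisfies
--   d² ≤ C · rad(d)³   and   |a|² ≤ C · rad(d)⁶.
-- If d = mⁿ with n ≥ 2 then rad(d) divides m, so rad(d)² ≤ m² ≤ d.  The first
-- inequality then gives d·d³ ≤ C²·d³, i.e. d ≤ C², and the second gives
-- |a| ≤ C·(C²)³.  Clearing denominators in the Weierstrass equation shows that
-- b is a root of a monic quadratic b² + B·b = R whose coefficients depend only
-- on (a, d), so |b| ≤ |B| + |R|.  Hence (a, b, d) lies in an explicit finite
-- box, and the point is determined by (a, b, d).

open import Defs
open import Data.Empty using (⊥-elim)
open import Data.Fin using (Fin; zero; suc)
open import Data.Integer as Z using (ℤ; +_; -[1+_])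
import Data.Integer.Properties as ZP
open import Data.Integer.Tactic.RingSolver using () renaming (solve-∀ to ℤ-solve-∀)
open import Data.List using (List; []; _∷_; filter; upTo; map; _++_; concatMap)
open import Data.List.Membership.Propositional using (_∈_)
open import Data.List.Membership.Propositional.Properties
  using (∈-map⁺; ∈-++⁺ˡ; ∈-++⁺ʳ; ∈-upTo⁺; ∈-concatMap⁺)
import Data.List.Relation.Unary.Any as Any
open import Data.List.Relation.Unary.All as All using (All; _∷_)
import Data.List.Relation.Unary.All.Properties as AllP
open import Data.List.Relation.Unary.AllPairs using (_∷_)
open import Data.List.Relation.Unary.Unique.Propositional using (Unique)
import Data.List.Relation.Unary.Unique.Propositional.Properties as UniqueP
open import Data.Nat as N using (ℕ; zero; suc; _^_; _≤_; _<_; _+_; _*_; z≤n; s≤s; NonZero)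
import Data.Nat.Properties as NP
open import Data.Nat.Divisibility using (_∣_; _∣?_; divides; ∣1⇒≡1; 1∣_; ∣⇒≤)
open import Data.Nat.ListAction using (product)
open import Data.Nat.Primality using (Prime; prime?; euclidsLemma; ¬prime[1])
open import Data.Nat.Primality.Factorisation using (factorisationHasAllPrimeFactors)
open import Data.Nat.Tactic.RingSolver using (solve-∀)
open import Data.Product using (Σ; _×_; _,_; proj₁; proj₂)
open import Data.Rational as Q using (ℚ)
import Data.Rational.Properties as QP
open import Data.Rational.Solver using (module +-*-Solver)
open +-*-Solver using (solve; _:+_; _:*_; _:=_)
open import Data.Rational.Unnormalised as ℚᵘ using (mkℚᵘ; *≡*; _≃_)
import Data.Rational.Unnormalised.Properties as ℚᵘP
open import Data.Sum using (inj₁; inj₂)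
open import Data.Vec as Vec using (Vec; []; _∷_; lookup)
open import Data.Vec.Properties using (lookup-map)
open import Relation.Nullary using (Dec; yes; no)
open import Relation.Nullary.Decidable using (_×-dec_)
open import Relation.Binary.PropositionalEquality

toℚᵘ-fromℤ : ∀ z → Q.toℚᵘ (fromℤ z) ≃ mkℚᵘ z 0
toℚᵘ-fromℤ z = QP.toℚᵘ-fromℚᵘ (mkℚᵘ z 0)

fromℤ-+ : ∀ z w → fromℤ (z Z.+ w) ≡ fromℤ z Q.+ fromℤ w
fromℤ-+ z w = QP.toℚᵘ-injective (begin
    Q.toℚᵘ (fromℤ (z Z.+ w))                ≈⟨ toℚᵘ-fromℤ (z Z.+ w) ⟩
    mkℚᵘ (z Z.+ w) 0                        ≈⟨ *≡* (sum-over-1 z w) ⟩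
    mkℚᵘ z 0 ℚᵘ.+ mkℚᵘ w 0                  ≈⟨ ℚᵘP.+-cong (toℚᵘ-fromℤ z) (toℚᵘ-fromℤ w) ⟨
    Q.toℚᵘ (fromℤ z) ℚᵘ.+ Q.toℚᵘ (fromℤ w)  ≈⟨ QP.toℚᵘ-homo-+ (fromℤ z) (fromℤ w) ⟨
    Q.toℚᵘ (fromℤ z Q.+ fromℤ w)            ∎)
  where
  open ℚᵘP.≃-Reasoning
  sum-over-1 : ∀ z w → (z Z.+ w) Z.* + 1 ≡ (z Z.* + 1 Z.+ w Z.* + 1) Z.* + 1
  sum-over-1 = ℤ-solve-∀

fromℤ-* : ∀ z w → fromℤ (z Z.* w) ≡ fromℤ z Q.* fromℤ w
fromℤ-* z w = QP.toℚᵘ-injective (begin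
    Q.toℚᵘ (fromℤ (z Z.* w))                ≈⟨ toℚᵘ-fromℤ (z Z.* w) ⟩
    mkℚᵘ (z Z.* w) 0                        ≈⟨ *≡* refl ⟩
    mkℚᵘ z 0 ℚᵘ.* mkℚᵘ w 0                  ≈⟨ ℚᵘP.*-cong (toℚᵘ-fromℤ z) (toℚᵘ-fromℤ w) ⟨
    Q.toℚᵘ (fromℤ z) ℚᵘ.* Q.toℚᵘ (fromℤ w)  ≈⟨ QP.toℚᵘ-homo-* (fromℤ z) (fromℤ w) ⟨
    Q.toℚᵘ (fromℤ z Q.* fromℤ w)            ∎)
  where open ℚᵘP.≃-Reasoning

fromℤ-injective : ∀ {z w} → fromℤ z ≡ fromℤ w → z ≡ w
fromℤ-injective {z} {w} eq
  with *≡* z*1≡w*1 ← ℚᵘP.≃-trans (ℚᵘP.≃-sym (toℚᵘ-fromℤ z))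
                       (ℚᵘP.≃-trans (QP.toℚᵘ-cong eq) (toℚᵘ-fromℤ w)) = begin
  z         ≡⟨ ZP.*-identityʳ z ⟨
  z Z.* + 1 ≡⟨ z*1≡w*1 ⟩
  w Z.* + 1 ≡⟨ ZP.*-identityʳ w ⟩
  w         ∎
  where open ≡-Reasoning

fromℤ-nonZero : ∀ n .{{_ : NonZero n}} → Q.NonZero (fromℤ (+ n))
fromℤ-nonZero n = Q.≢-nonZero (λ n≡0 → N.≢-nonZero⁻¹ n (ZP.+-injective (fromℤ-injective n≡0)))

fromℤ-^-nonZero : ∀ d k .{{_ : NonZero d}} → Q.NonZero (fromℤ (+ (d ^ k)))
fromℤ-^-nonZero d k = fromℤ-nonZero (d ^ k) {{NP.m^n≢0 d k}}

fromℤ-pos-* : ∀ m n → fromℤ (+ (m * n)) ≡ fromℤ (+ m) Q.* fromℤ (+ n)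
fromℤ-pos-* m n = trans (cong fromℤ (ZP.pos-* m n)) (fromℤ-* (+ m) (+ n))

fromℤ-square : ∀ d → fromℤ (+ (d ^ 2)) ≡ fromℤ (+ d) Q.* fromℤ (+ d)
fromℤ-square d = begin
  fromℤ (+ (d ^ 2))           ≡⟨ cong (λ n → fromℤ (+ (d * n))) (NP.*-identityʳ d) ⟩
  fromℤ (+ (d * d))           ≡⟨ fromℤ-pos-* d d ⟩
  fromℤ (+ d) Q.* fromℤ (+ d) ∎
  where open ≡-Reasoning

fromℤ-cube : ∀ d → fromℤ (+ (d ^ 3)) ≡ fromℤ (+ d) Q.* fromℤ (+ d) Q.* fromℤ (+ d)
fromℤ-cube d = begin
  fromℤ (+ (d ^ 3))                           ≡⟨ cong (λ n → fromℤ (+ n)) (cube d) ⟩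
  fromℤ (+ (d * d * d))                       ≡⟨ fromℤ-pos-* (d * d) d ⟩
  fromℤ (+ (d * d)) Q.* fromℤ (+ d)           ≡⟨ cong (Q._* fromℤ (+ d)) (fromℤ-pos-* d d) ⟩
  fromℤ (+ d) Q.* fromℤ (+ d) Q.* fromℤ (+ d) ∎
  where
  open ≡-Reasoning
  cube : ∀ d → d * (d * (d * 1)) ≡ d * d * d
  cube = solve-∀

data Poly (n : ℕ) : Set where
  var     : Fin n → Poly n
  _⊕_ _⊗_ : Poly n → Poly n → Poly n

infixl 6 _⊕_
infixl 7 _⊗_

module _ {A : Set} (_+ᴬ_ _*ᴬ_ : A → A → A) where
  eval : ∀ {n} → Poly n → Vec A n → A
  eval (var i) ρ = lookup ρ i
  eval (e ⊕ f) ρ = eval e ρ +ᴬ eval f ρ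
  eval (e ⊗ f) ρ = eval e ρ *ᴬ eval f ρ

⟦_⟧ℤ : ∀ {n} → Poly n → Vec ℤ n → ℤ
⟦_⟧ℤ = eval Z._+_ Z._*_

⟦_⟧ℚ : ∀ {n} → Poly n → Vec ℚ n → ℚ
⟦_⟧ℚ = eval Q._+_ Q._*_

fromℤ-⟦⟧ : ∀ {n} (e : Poly n) (ρ : Vec ℤ n) → fromℤ (⟦ e ⟧ℤ ρ) ≡ ⟦ e ⟧ℚ (Vec.map fromℤ ρ)
fromℤ-⟦⟧ (var i) ρ = sym (lookup-map i fromℤ ρ)
fromℤ-⟦⟧ (e ⊕ f) ρ =
  trans (fromℤ-+ (⟦ e ⟧ℤ ρ) (⟦ f ⟧ℤ ρ)) (cong₂ Q._+_ (fromℤ-⟦⟧ e ρ) (fromℤ-⟦⟧ f ρ))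
fromℤ-⟦⟧ (e ⊗ f) ρ =
  trans (fromℤ-* (⟦ e ⟧ℤ ρ) (⟦ f ⟧ℤ ρ)) (cong₂ Q._*_ (fromℤ-⟦⟧ e ρ) (fromℤ-⟦⟧ f ρ))

α₁ α₂ α₃ α₄ α₆ X Y Z : Poly 8
α₁ = var zero
α₂ = var (suc zero)
α₃ = var (suc (suc zero))
α₄ = var (suc (suc (suc zero)))
α₆ = var (suc (suc (suc (suc zero))))
X  = var (suc (suc (suc (suc (suc zero)))))
Y  = var (suc (suc (suc (suc (suc (suc zero))))))
Z  = var (suc (suc (suc (suc (suc (suc (suc zero)))))))

homogenisedLHS homogenisedRHS : Poly 8
homogenisedLHS = Y ⊗ Y ⊕ (α₁ ⊗ X ⊗ Z ⊕ α₃ ⊗ (Z ⊗ Z ⊗ Z)) ⊗ Y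
homogenisedRHS = X ⊗ X ⊗ X ⊕ α₂ ⊗ X ⊗ X ⊗ (Z ⊗ Z) ⊕ α₄ ⊗ X ⊗ (Z ⊗ Z ⊗ Z ⊗ Z)
                 ⊕ α₆ ⊗ (Z ⊗ Z ⊗ Z ⊗ Z ⊗ Z ⊗ Z)

assignment : {A : Set} → (ℤ → A) → Weierstrass → A → A → A → Vec A 8
assignment ι W x y z = ι (a₁ W) ∷ ι (a₂ W) ∷ ι (a₃ W) ∷ ι (a₄ W) ∷ ι (a₆ W) ∷ x ∷ y ∷ z ∷ []

-- Seen as an equation in b = Y, the integral homogenised equation at
-- (X, Z) = (a, d) is the monic quadratic b² + B·b = R with these coefficients.
linearCoefficient constantTerm : Weierstrass → ℤ → ℕ → ℤ
linearCoefficient W a d = a₁ W Z.* a Z.* + d Z.+ a₃ W Z.* (+ d Z.* + d Z.* + d)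
constantTerm W a d =
  a Z.* a Z.* a Z.+ a₂ W Z.* a Z.* a Z.* (+ d Z.* + d)
  Z.+ a₄ W Z.* a Z.* (+ d Z.* + d Z.* + d Z.* + d)
  Z.+ a₆ W Z.* (+ d Z.* + d Z.* + d Z.* + d Z.* + d Z.* + d)

weight-LHS : ∀ W x y z →
  ⟦ homogenisedLHS ⟧ℚ (assignment fromℤ W (x Q.* (z Q.* z)) (y Q.* (z Q.* z Q.* z)) z)
    ≡ (z Q.* z Q.* z Q.* z Q.* z Q.* z)
      Q.* (y Q.* y Q.+ fromℤ (a₁ W) Q.* x Q.* y Q.+ fromℤ (a₃ W) Q.* y)
weight-LHS W = solve 5 (λ c₁ c₃ x y z →
    (y :* (z :* z :* z)) :* (y :* (z :* z :* z))
      :+ (c₁ :* (x :* (z :* z)) :* z :+ c₃ :* (z :* z :* z)) :* (y :* (z :* z :* z))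
    := (z :* z :* z :* z :* z :* z) :* (y :* y :+ c₁ :* x :* y :+ c₃ :* y))
  refl (fromℤ (a₁ W)) (fromℤ (a₃ W))

weight-RHS : ∀ W x y z →
  ⟦ homogenisedRHS ⟧ℚ (assignment fromℤ W (x Q.* (z Q.* z)) y z)
    ≡ (z Q.* z Q.* z Q.* z Q.* z Q.* z)
      Q.* (x Q.* x Q.* x Q.+ fromℤ (a₂ W) Q.* x Q.* x Q.+ fromℤ (a₄ W) Q.* x Q.+ fromℤ (a₆ W))
weight-RHS W x y = solve 5 (λ c₂ c₄ c₆ x z →
    (x :* (z :* z)) :* (x :* (z :* z)) :* (x :* (z :* z))
      :+ c₂ :* (x :* (z :* z)) :* (x :* (z :* z)) :* (z :* z)
      :+ c₄ :* (x :* (z :* z)) :* (z :* z :* z :* z) :+ c₆ :* (z :* z :* z :* z :* z :* z)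
    := (z :* z :* z :* z :* z :* z) :* (x :* x :* x :+ c₂ :* x :* x :+ c₄ :* x :+ c₆))
  refl (fromℤ (a₂ W)) (fromℤ (a₄ W)) (fromℤ (a₆ W)) x

integralWeierstrass : ∀ E x y a b d → OnCurve E x y → Repr x y a b d →
  b Z.* b Z.+ linearCoefficient (eqn E) a d Z.* b ≡ constantTerm (eqn E) a d
integralWeierstrass E x y a b d onCurve (_ , _ , x-eq , y-eq) = fromℤ-injective (begin
  fromℤ (⟦ homogenisedLHS ⟧ℤ ρ)                   ≡⟨ fromℤ-⟦⟧ homogenisedLHS ρ ⟩
  ⟦ homogenisedLHS ⟧ℚ (σ (fromℤ a) (fromℤ b))     ≡⟨ cong₂ (λ u v → ⟦ homogenisedLHS ⟧ℚ (σ u v)) xδ²≡a yδ³≡b ⟨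
  ⟦ homogenisedLHS ⟧ℚ (σ (x Q.* δ²) (y Q.* δ³))   ≡⟨ weight-LHS W x y δ ⟩
  δ⁶ Q.* affineLHS                                ≡⟨ cong (δ⁶ Q.*_) onCurve ⟩
  δ⁶ Q.* affineRHS                                ≡⟨ weight-RHS W x (y Q.* δ³) δ ⟨
  ⟦ homogenisedRHS ⟧ℚ (σ (x Q.* δ²) (y Q.* δ³))   ≡⟨ cong₂ (λ u v → ⟦ homogenisedRHS ⟧ℚ (σ u v)) xδ²≡a yδ³≡b ⟩
  ⟦ homogenisedRHS ⟧ℚ (σ (fromℤ a) (fromℤ b))     ≡⟨ fromℤ-⟦⟧ homogenisedRHS ρ ⟨
  fromℤ (⟦ homogenisedRHS ⟧ℤ ρ)                   ∎)
  where
  open ≡-Reasoning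
  W : Weierstrass
  W = eqn E
  ρ : Vec ℤ 8
  ρ = assignment (λ c → c) W a b (+ d)
  δ δ² δ³ δ⁶ affineLHS affineRHS : ℚ
  δ  = fromℤ (+ d)
  δ² = δ Q.* δ
  δ³ = δ Q.* δ Q.* δ
  δ⁶ = δ Q.* δ Q.* δ Q.* δ Q.* δ Q.* δ
  affineLHS = y Q.* y Q.+ fromℤ (a₁ W) Q.* x Q.* y Q.+ fromℤ (a₃ W) Q.* y
  affineRHS = x Q.* x Q.* x Q.+ fromℤ (a₂ W) Q.* x Q.* x Q.+ fromℤ (a₄ W) Q.* x Q.+ fromℤ (a₆ W)
  σ : ℚ → ℚ → Vec ℚ 8
  σ u v = assignment fromℤ W u v δ
  xδ²≡a : x Q.* δ² ≡ fromℤ a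
  xδ²≡a = trans (cong (x Q.*_) (sym (fromℤ-square d))) x-eq
  yδ³≡b : y Q.* δ³ ≡ fromℤ b
  yδ³≡b = trans (cong (y Q.*_) (sym (fromℤ-cube d))) y-eq

linear<quadratic : ∀ m k r → r + k * suc m < suc m * suc (k + r)
linear<quadratic m k r = NP.≤-trans (NP.m≤m+n _ (m + m * r)) (NP.≤-reflexive (expand m k r))
  where
  expand : ∀ m k r → suc (r + k * suc m) + (m + m * r) ≡ suc m * suc (k + r)
  expand = solve-∀

-- In ℕ: if n² ≤ r + k·n then n ≤ k + r, since n ≥ k + r + 1 would give
-- n² ≥ n·(k + r + 1) > r + k·n.
square≤linear⇒≤ : ∀ n k r → n * n ≤ r + k * n → n ≤ k + r
square≤linear⇒≤ zero    k r _   = z≤n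
square≤linear⇒≤ (suc m) k r n²≤ with suc m N.≤? k + r
... | yes n≤k+r = n≤k+r
... | no  n≰k+r = ⊥-elim (NP.<⇒≱ (NP.<-≤-trans (linear<quadratic m k r)
                                    (NP.*-monoʳ-≤ (suc m) (NP.≰⇒> n≰k+r))) n²≤)

monicQuadraticRoot-bound : ∀ b B R → b Z.* b Z.+ B Z.* b ≡ R → Z.∣ b ∣ ≤ Z.∣ B ∣ + Z.∣ R ∣
monicQuadraticRoot-bound b B R eq = square≤linear⇒≤ Z.∣ b ∣ Z.∣ B ∣ Z.∣ R ∣ (begin
  Z.∣ b ∣ * Z.∣ b ∣               ≡⟨ ZP.∣i*j∣≡∣i∣*∣j∣ b b ⟨
  Z.∣ b Z.* b ∣                   ≡⟨ cong Z.∣_∣ b²≡R-Bb ⟩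
  Z.∣ R Z.- B Z.* b ∣             ≤⟨ ZP.∣i+j∣≤∣i∣+∣j∣ R (Z.- (B Z.* b)) ⟩
  Z.∣ R ∣ + Z.∣ Z.- (B Z.* b) ∣   ≡⟨ cong (λ t → Z.∣ R ∣ + t) (ZP.∣-i∣≡∣i∣ (B Z.* b)) ⟩
  Z.∣ R ∣ + Z.∣ B Z.* b ∣         ≡⟨ cong (λ t → Z.∣ R ∣ + t) (ZP.∣i*j∣≡∣i∣*∣j∣ B b) ⟩
  Z.∣ R ∣ + Z.∣ B ∣ * Z.∣ b ∣     ∎)
  where
  open NP.≤-Reasoning
  add-sub : ∀ u v → u Z.+ v Z.- v ≡ u
  add-sub = ℤ-solve-∀
  b²≡R-Bb : b Z.* b ≡ R Z.- B Z.* b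
  b²≡R-Bb = trans (sym (add-sub (b Z.* b) (B Z.* b))) (cong (Z._- B Z.* b) eq)

prime∣^⇒∣ : ∀ {p} m n → Prime p → p ∣ m ^ n → p ∣ m
prime∣^⇒∣ m zero    p-prime p∣1 = ⊥-elim (¬prime[1] (subst Prime (∣1⇒≡1 p∣1) p-prime))
prime∣^⇒∣ m (suc n) p-prime p∣m·mⁿ with euclidsLemma m (m ^ n) p-prime p∣m·mⁿ
... | inj₁ p∣m  = p∣m
... | inj₂ p∣mⁿ = prime∣^⇒∣ m n p-prime p∣mⁿ

-- A product of distinct primes, each dividing m, divides m: if m = k·Πps and
-- p divides m but not Πps (p is not among the primes ps), then p divides k.
product-distinctPrimes∣ : ∀ m ps → Unique ps → All (λ p → Prime p × p ∣ m) ps → product ps ∣ m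
product-distinctPrimes∣ m []       _                 _                    = 1∣ m
product-distinctPrimes∣ m (p ∷ ps) (p∉ps ∷ distinct) ((p-prime , p∣m) ∷ rest)
  with divides k m≡k·Πps ← product-distinctPrimes∣ m ps distinct rest
  with euclidsLemma k (product ps) p-prime (subst (p ∣_) m≡k·Πps p∣m)
... | inj₂ p∣Πps = ⊥-elim (AllP.All¬⇒¬Any p∉ps
                      (factorisationHasAllPrimeFactors p-prime p∣Πps (All.map proj₁ rest)))
... | inj₁ (divides j k≡j·p) = divides j (begin
  m                   ≡⟨ m≡k·Πps ⟩
  k * product ps      ≡⟨ cong (_* product ps) k≡j·p ⟩
  j * p * product ps  ≡⟨ NP.*-assoc j p (product ps) ⟩
  j * (p * product ps) ∎)
  where open ≡-Reasoning

-- rad(mⁿ) divides m: rad(mⁿ) is a product of distinct primes dividing mⁿ,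
-- and each of them divides m.
rad-^∣ : ∀ m n → rad (m ^ n) ∣ m
rad-^∣ m n = product-distinctPrimes∣ m primeDivisors
  (UniqueP.filter⁺ isPrimeDivisor? (UniqueP.upTo⁺ (suc (m ^ n))))
  (All.map (λ (p-prime , p∣mⁿ) → p-prime , prime∣^⇒∣ m n p-prime p∣mⁿ)
           (AllP.all-filter isPrimeDivisor? (upTo (suc (m ^ n)))))
  where
  isPrimeDivisor? : (p : ℕ) → Dec (Prime p × p ∣ m ^ n)
  isPrimeDivisor? p = prime? p ×-dec p ∣? (m ^ n)
  primeDivisors : List ℕ
  primeDivisors = filter isPrimeDivisor? (upTo (suc (m ^ n)))

perfectPower⇒rad²≤ : ∀ {d} → PerfectPower d → rad d ^ 2 ≤ d
perfectPower⇒rad²≤ (m , n , 1≤m , 2≤n , refl) = begin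
  rad (m ^ n) ^ 2 ≤⟨ NP.^-monoˡ-≤ 2 (∣⇒≤ (rad-^∣ m n)) ⟩
  m ^ 2           ≤⟨ NP.^-monoʳ-≤ m 2≤n ⟩
  m ^ n           ∎
  where
  open NP.≤-Reasoning
  instance
    m≢0 : NonZero m
    m≢0 = N.>-nonZero 1≤m

-- If d² ≤ C·r³ and r² ≤ d (with d ≥ 1) then d ≤ C², because
-- d·d³ = (d²)² ≤ (C·r³)² = C²·(r²)³ ≤ C²·d³.
denominator-bound : ∀ C r d .{{_ : NonZero d}} → d ^ 2 ≤ C * r ^ 3 → r ^ 2 ≤ d → d ≤ C ^ 2
denominator-bound C r d d²≤Cr³ r²≤d = NP.*-cancelʳ-≤ d (C ^ 2) (d ^ 3) {{NP.m^n≢0 d 3}} (begin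
  d * d ^ 3           ≡⟨ NP.^-*-assoc d 2 2 ⟨
  (d ^ 2) ^ 2         ≤⟨ NP.^-monoˡ-≤ 2 d²≤Cr³ ⟩
  (C * r ^ 3) ^ 2     ≡⟨ regroup C r ⟩
  C ^ 2 * (r ^ 2) ^ 3 ≤⟨ NP.*-monoʳ-≤ (C ^ 2) (NP.^-monoˡ-≤ 3 r²≤d) ⟩
  C ^ 2 * d ^ 3       ∎)
  where
  open NP.≤-Reasoning
  -- (C·r³)² = C²·(r²)³, with the powers unfolded into products
  regroup : ∀ C r → (C * (r * (r * (r * 1)))) * ((C * (r * (r * (r * 1)))) * 1)
                  ≡ (C * (C * 1)) * ((r * (r * 1)) * ((r * (r * 1)) * ((r * (r * 1)) * 1)))
  regroup = solve-∀

numerator-bound : ∀ C r d D n → n ^ 2 ≤ C * r ^ 6 → r ^ 2 ≤ d → d ≤ D → n ≤ C * D ^ 3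
numerator-bound C r d D zero    _        _    _   = z≤n
numerator-bound C r d D n@(suc _) n²≤Cr⁶ r²≤d d≤D = begin
  n               ≤⟨ NP.m≤m*n n (n * 1) ⟩
  n ^ 2           ≤⟨ n²≤Cr⁶ ⟩
  C * r ^ 6       ≡⟨ cong (C *_) (NP.^-*-assoc r 2 3) ⟨
  C * (r ^ 2) ^ 3 ≤⟨ NP.*-monoʳ-≤ C (NP.^-monoˡ-≤ 3 (NP.≤-trans r²≤d d≤D)) ⟩
  C * D ^ 3       ∎
  where open NP.≤-Reasoning

integersUpTo : ℕ → List ℤ
integersUpTo K = map +_ (upTo (suc K)) ++ map -[1+_] (upTo K)

∈-integersUpTo : ∀ {K} z → Z.∣ z ∣ ≤ K → z ∈ integersUpTo K
∈-integersUpTo (+ n)    n≤K = ∈-++⁺ˡ (∈-map⁺ +_ (∈-upTo⁺ (s≤s n≤K)))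
∈-integersUpTo -[1+ n ] n<K = ∈-++⁺ʳ _ (∈-map⁺ -[1+_] (∈-upTo⁺ n<K))

∈-concatMap : ∀ {A B : Set} (f : A → List B) {x xs y} → x ∈ xs → y ∈ f x → y ∈ concatMap f xs
∈-concatMap f x∈xs y∈fx = ∈-concatMap⁺ f (Any.map (λ x≡z → subst (λ z → _ ∈ f z) x≡z y∈fx) x∈xs)

*-solve : ∀ {x z} c .{{_ : Q.NonZero c}} → x Q.* c ≡ z → x ≡ z Q.÷ c
*-solve {x} {z} c x·c≡z = begin
  x                     ≡⟨ QP.*-identityʳ x ⟨
  x Q.* Q.1ℚ            ≡⟨ cong (x Q.*_) (QP.*-inverseʳ c) ⟨
  x Q.* (c Q.* Q.1/ c)  ≡⟨ QP.*-assoc x c (Q.1/ c) ⟨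
  x Q.* c Q.* Q.1/ c    ≡⟨ cong (Q._* Q.1/ c) x·c≡z ⟩
  z Q.÷ c               ∎
  where open ≡-Reasoning

pointOf : ℤ → ℤ → (d : ℕ) → .{{NonZero d}} → ℚ × ℚ
pointOf a b d = (fromℤ a Q.÷ fromℤ (+ (d ^ 2))) {{fromℤ-^-nonZero d 2}}
              , (fromℤ b Q.÷ fromℤ (+ (d ^ 3))) {{fromℤ-^-nonZero d 3}}

Repr⇒≡pointOf : ∀ {x y} a b d .{{_ : NonZero d}} → Repr x y a b d → (x , y) ≡ pointOf a b d
Repr⇒≡pointOf a b d (_ , _ , x-eq , y-eq) = cong₂ _,_
  (*-solve _ {{fromℤ-^-nonZero d 2}} x-eq)
  (*-solve _ {{fromℤ-^-nonZero d 3}} y-eq)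

rootBound : Weierstrass → ℤ → ℕ → ℕ
rootBound W a d = Z.∣ linearCoefficient W a d ∣ + Z.∣ constantTerm W a d ∣

candidatesAt : Weierstrass → ℕ → ℤ → List (ℚ × ℚ)
candidatesAt W k a = map (λ b → pointOf a b (suc k)) (integersUpTo (rootBound W a (suc k)))

candidates : Weierstrass → ℕ → ℕ → List (ℚ × ℚ)
candidates W D A = concatMap (λ k → concatMap (candidatesAt W k) (integersUpTo A)) (upTo D)

∈-candidates : ∀ W {D A} a b {k} → suc k ≤ D → Z.∣ a ∣ ≤ A → Z.∣ b ∣ ≤ rootBound W a (suc k) →
               pointOf a b (suc k) ∈ candidates W D A
∈-candidates W {A = A} a b {k} d≤D a≤A b≤ =
  ∈-concatMap (λ k → concatMap (candidatesAt W k) (integersUpTo A)) (∈-upTo⁺ d≤D)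
    (∈-concatMap (candidatesAt W k) (∈-integersUpTo a a≤A)
      (∈-map⁺ (λ b → pointOf a b (suc k)) (∈-integersUpTo b b≤)))

corollary1p7 : ((E' : EllipticCurve) → RadicalBound E') →
    (E : EllipticCurve) →
    FinitePoints (λ x y → OnCurve E x y ×
    Σ ℤ λ a → Σ ℤ λ b → Σ ℕ λ d → Repr x y a b d × PerfectPower d)
corollary1p7 radicalBound E with C , bound ← radicalBound E 1 2 (s≤s z≤n) (s≤s z≤n) =
  candidates W D A , covered
  where
  W : Weierstrass
  W = eqn E
  D A : ℕ
  D = C ^ 2
  A = C * D ^ 3
  covered : ∀ x y → OnCurve E x y ×
            (Σ ℤ λ a → Σ ℤ λ b → Σ ℕ λ d → Repr x y a b d × PerfectPower d) →
            (x , y) ∈ candidates W D A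
  covered x y (_ , _ , _ , zero , (() , _) , _)
  covered x y (onCurve , a , b , d@(suc k) , repr , perfectPower) =
    subst (_∈ candidates W D A) (sym (Repr⇒≡pointOf a b d repr)) (∈-candidates W a b d≤D a≤A b≤)
    where
    r²≤d : rad d ^ 2 ≤ d
    r²≤d = perfectPower⇒rad²≤ perfectPower
    bounds : d ^ 2 ≤ C * rad d ^ 3 × Z.∣ a ∣ ^ 2 ≤ C * rad d ^ 6
    bounds = bound x y onCurve a b d repr
    d≤D : d ≤ D
    d≤D = denominator-bound C (rad d) d (proj₁ bounds) r²≤d
    a≤A : Z.∣ a ∣ ≤ A
    a≤A = numerator-bound C (rad d) d D Z.∣ a ∣ (proj₂ bounds) r²≤d d≤D
    b≤ : Z.∣ b ∣ ≤ rootBound W a d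
    b≤ = monicQuadraticRoot-bound b (linearCoefficient W a d) (constantTerm W a d)
           (integralWeierstrass E x y a b d onCurve repr)
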